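{- For each ground type $\gamma$ there is a constant $k_\gamma$ such that for every type-$\gamma$ value term graph $v$, the total number of vertices of $v$ is at most $k_\gamma\cdot(1+\mathrm{size}(v))$.
   Context: Ground types are built by $\gamma::=\mathsf{unit}\mid\mu P\mid\gamma+\gamma\mid\gamma\times\gamma$ where $P$ is a polynomial functor ($P::=\mathrm{Id}\mid\mathsf C_N\mid P+P\mid P\times P$, $N$ a base type) and $\mu P$ its least fixed point. A type-$\gamma$ value term graph is a rooted labelled dag (sharing allowed): for $\mathsf{unit}$ a single vertex $\underline{()}$; for $\gamma_1\times\gamma_2$ a root labelled pair with out-edges to the roots of a type-$\gamma_1$ and a type-$\gamma_2$ value (the union of the two graphs); for $\gamma_1+\gamma_2$ a root labelled $\underline\iota_j$ with an out-edge to the root of a type-$\gamma_j$ value; for $\mu P$ a root labelled $\underline{\mathsf c}_{\mu P}$ with an out-edge to the root of a type-$P(\mu P)$ value. $\mathrm{size}(v)$ is the number of $\underline{\mathsf c}_{\mu P}$-labelled vertices of $v$ (vertices labelled $\underline{()}$, $\underline\iota_j$, pair are not counted). -}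

module Defs where

open import Data.Nat using (ℕ; zero; suc; _+_)
open import Data.Fin using (Fin)
open import Data.List using (List; []; _∷_; map; allFin)
open import Data.Nat.ListAction using (sum)
open import Data.List.Membership.Propositional using (_∈_)
open import Relation.Binary.PropositionalEquality using (_≡_)

mutual
  data Ground : Set where
    unit : Ground
    μ    : Poly → Ground
    _⊕_  : Ground → Ground → Ground
    _⊗_  : Ground → Ground → Ground

  data Poly : Set where
    Id   : Poly
    C    : Ground → Poly
    _+ᴾ_ : Poly → Poly → Poly
    _×ᴾ_ : Poly → Poly → Poly

apply : Poly → Ground → Ground
apply Id         g = g
apply (C N)      g = N
apply (P +ᴾ Q)   g = apply P g ⊕ apply Q g
apply (P ×ᴾ Q)   g = apply P g ⊗ apply Q g

data Label : Set where
  lunit : Label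
  lpair : Label
  linl  : Label
  linr  : Label
  lcon  : Poly → Label

record Graph : Set where
  field
    n     : ℕ
    label : Fin n → Label
    succ  : Fin n → List (Fin n)
open Graph public

data IsValue (G : Graph) : Ground → Fin (n G) → Set where
  v-unit : ∀ {v} → label G v ≡ lunit → succ G v ≡ [] → IsValue G unit v
  v-pair : ∀ {γ₁ γ₂ v a b} → label G v ≡ lpair → succ G v ≡ a ∷ b ∷ [] →
           IsValue G γ₁ a → IsValue G γ₂ b → IsValue G (γ₁ ⊗ γ₂) v
  v-inl  : ∀ {γ₁ γ₂ v a} → label G v ≡ linl → succ G v ≡ a ∷ [] →
           IsValue G γ₁ a → IsValue G (γ₁ ⊕ γ₂) v
  v-inr  : ∀ {γ₁ γ₂ v a} → label G v ≡ linr → succ G v ≡ a ∷ [] →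
           IsValue G γ₂ a → IsValue G (γ₁ ⊕ γ₂) v
  v-con  : ∀ {P v a} → label G v ≡ lcon P → succ G v ≡ a ∷ [] →
           IsValue G (apply P (μ P)) a → IsValue G (μ P) v

data Reach (G : Graph) (r : Fin (n G)) : Fin (n G) → Set where
  here : Reach G r r
  step : ∀ {u w} → Reach G r u → w ∈ succ G u → Reach G r w

record ValueGraph (γ : Ground) : Set where
  field
    graph   : Graph
    root    : Fin (n graph)
    typed   : IsValue graph γ root
    rooted  : ∀ v → Reach graph root v
open ValueGraph public

isCon : Label → ℕ
isCon (lcon _) = 1
isCon _        = 0

vertices : ∀ {γ} → ValueGraph γ → ℕ
vertices v = n (graph v)

size : ∀ {γ} → ValueGraph γ → ℕ
size v = sum (map (λ x → isCon (label (graph v) x)) (allFin (n (graph v))))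

{-# OPTIONS --safe #-}
-- Cut a value term graph at its μ-constructor vertices. The pieces ("layers") are the part
-- of the value of type γ above the first constructors, and for every constructor vertex the
-- part of its argument of type P(μP) above the next constructors. A layer of type τ has at
-- most `width τ` vertices, where μ-types count as leaves; `widthBound γ` bounds the width of
-- γ and of P(μP) for every μP that can occur while unfolding γ. As every vertex is reachable
-- from the root, it lies in one of the 1 + size(v) layers.
module Submission where

open import Defs
open import Data.Nat using (ℕ; _≤_; _*_; _+_; s≤s; z≤n)
open import Data.Nat.Properties
open import Data.Product using (Σ; _×_; _,_)
open import Data.Unit using (⊤; tt)
open import Data.Fin using (Fin)
open import Data.Fin.Properties using (injective⇒≤)
open import Data.List using (List; []; _∷_; _++_; length; take; map; concatMap; allFin)
open import Data.List.Properties using (take-all; length-take; length-++)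
open import Data.Nat.ListAction using (sum)
open import Data.List.Membership.Propositional using (_∈_; lose)
open import Data.List.Membership.Propositional.Properties using (∈-allFin; ∈-++⁺ˡ; ∈-++⁺ʳ; ∈-concatMap⁺)
open import Data.List.Membership.Setoid.Properties using (index-injective)
open import Data.List.Relation.Binary.Subset.Propositional using (_⊆_)
open import Data.List.Relation.Unary.Any using (here; there)
open import Relation.Binary.PropositionalEquality

length-take≤ : ∀ {A : Set} m (xs : List A) → length (take m xs) ≤ m
length-take≤ m xs = ≤-trans (≤-reflexive (length-take m xs)) (m⊓n≤m m _)

length-concatMap≤ : ∀ {A B : Set} K (f : A → List B) (g : A → ℕ) →
                    (∀ x → length (f x) ≤ K * g x) →
                    ∀ xs → length (concatMap f xs) ≤ K * sum (map g xs)
length-concatMap≤ K f g bound []       = z≤n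
length-concatMap≤ K f g bound (x ∷ xs) = begin
  length (f x ++ concatMap f xs)              ≡⟨ length-++ (f x) ⟩
  length (f x) + length (concatMap f xs)      ≤⟨ +-mono-≤ (bound x) (length-concatMap≤ K f g bound xs) ⟩
  K * g x + K * sum (map g xs)                ≡⟨ *-distribˡ-+ K (g x) _ ⟨
  K * sum (map g (x ∷ xs))                    ∎
  where open ≤-Reasoning

complete⇒≤length : ∀ {m} (xs : List (Fin m)) → (∀ i → i ∈ xs) → m ≤ length xs
complete⇒≤length xs complete =
  injective⇒≤ λ {i} {j} → index-injective (setoid _) (complete i) (complete j)

width : Ground → ℕ
width unit    = 1
width (μ P)   = 1
width (a ⊕ b) = 1 + width a + width b
width (a ⊗ b) = 1 + width a + width b

mutual
  WidthBounded : ℕ → Ground → Set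
  WidthBounded K unit    = ⊤
  WidthBounded K (μ P)   = width (apply P (μ P)) ≤ K × WidthBoundedᴾ K P
  WidthBounded K (a ⊕ b) = WidthBounded K a × WidthBounded K b
  WidthBounded K (a ⊗ b) = WidthBounded K a × WidthBounded K b

  WidthBoundedᴾ : ℕ → Poly → Set
  WidthBoundedᴾ K Id       = ⊤
  WidthBoundedᴾ K (C N)    = WidthBounded K N
  WidthBoundedᴾ K (P +ᴾ Q) = WidthBoundedᴾ K P × WidthBoundedᴾ K Q
  WidthBoundedᴾ K (P ×ᴾ Q) = WidthBoundedᴾ K P × WidthBoundedᴾ K Q

widthBounded-apply : ∀ {K} P Q → WidthBounded K (μ P) → WidthBoundedᴾ K Q →
                     WidthBounded K (apply Q (μ P))
widthBounded-apply P Id       bμ _         = bμ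
widthBounded-apply P (C N)    bμ bN        = bN
widthBounded-apply P (Q +ᴾ R) bμ (bQ , bR) = widthBounded-apply P Q bμ bQ , widthBounded-apply P R bμ bR
widthBounded-apply P (Q ×ᴾ R) bμ (bQ , bR) = widthBounded-apply P Q bμ bQ , widthBounded-apply P R bμ bR

mutual
  widthBound : Ground → ℕ
  widthBound unit    = 1
  widthBound (μ P)   = 1 + widthBoundᴾ P
  widthBound (a ⊕ b) = 1 + widthBound a + widthBound b
  widthBound (a ⊗ b) = 1 + widthBound a + widthBound b

  widthBoundᴾ : Poly → ℕ
  widthBoundᴾ Id       = 1
  widthBoundᴾ (C N)    = widthBound N
  widthBoundᴾ (P +ᴾ Q) = 1 + widthBoundᴾ P + widthBoundᴾ Q
  widthBoundᴾ (P ×ᴾ Q) = 1 + widthBoundᴾ P + widthBoundᴾ Q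

width≤widthBound : ∀ τ → width τ ≤ widthBound τ
width≤widthBound unit    = ≤-refl
width≤widthBound (μ P)   = s≤s z≤n
width≤widthBound (a ⊕ b) = s≤s (+-mono-≤ (width≤widthBound a) (width≤widthBound b))
width≤widthBound (a ⊗ b) = s≤s (+-mono-≤ (width≤widthBound a) (width≤widthBound b))

width-apply≤widthBoundᴾ : ∀ P Q → width (apply Q (μ P)) ≤ widthBoundᴾ Q
width-apply≤widthBoundᴾ P Id       = ≤-refl
width-apply≤widthBoundᴾ P (C N)    = width≤widthBound N
width-apply≤widthBoundᴾ P (Q +ᴾ R) = s≤s (+-mono-≤ (width-apply≤widthBoundᴾ P Q) (width-apply≤widthBoundᴾ P R))
width-apply≤widthBoundᴾ P (Q ×ᴾ R) = s≤s (+-mono-≤ (width-apply≤widthBoundᴾ P Q) (width-apply≤widthBoundᴾ P R))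

private
  1+m+n≤⇒m≤ : ∀ {m n k} → 1 + m + n ≤ k → m ≤ k
  1+m+n≤⇒m≤ le = m+n≤o⇒m≤o _ (m+n≤o⇒n≤o 1 le)

  1+m+n≤⇒n≤ : ∀ {m n k} → 1 + m + n ≤ k → n ≤ k
  1+m+n≤⇒n≤ {m} le = m+n≤o⇒n≤o (1 + m) le

mutual
  widthBounded : ∀ {K} τ → widthBound τ ≤ K → WidthBounded K τ
  widthBounded unit    le = tt
  widthBounded (μ P)   le = ≤-trans (width-apply≤widthBoundᴾ P P) le′ , widthBoundedᴾ P le′
    where le′ = m+n≤o⇒n≤o 1 le
  widthBounded (a ⊕ b) le = widthBounded a (1+m+n≤⇒m≤ le) , widthBounded b (1+m+n≤⇒n≤ le)
  widthBounded (a ⊗ b) le = widthBounded a (1+m+n≤⇒m≤ le) , widthBounded b (1+m+n≤⇒n≤ le)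

  widthBoundedᴾ : ∀ {K} P → widthBoundᴾ P ≤ K → WidthBoundedᴾ K P
  widthBoundedᴾ Id       le = tt
  widthBoundedᴾ (C N)    le = widthBounded N le
  widthBoundedᴾ (P +ᴾ Q) le = widthBoundedᴾ P (1+m+n≤⇒m≤ le) , widthBoundedᴾ Q (1+m+n≤⇒n≤ le)
  widthBoundedᴾ (P ×ᴾ Q) le = widthBoundedᴾ P (1+m+n≤⇒m≤ le) , widthBoundedᴾ Q (1+m+n≤⇒n≤ le)

module Layers (G : Graph) where

  private
    V : Set
    V = Fin (n G)

  mutual
    layer : Ground → V → List V
    layer unit    x = x ∷ []
    layer (μ P)   x = x ∷ []
    layer (a ⊗ b) x = x ∷ pairLayer a b (succ G x)
    layer (a ⊕ b) x = x ∷ sumLayer a b (label G x) (succ G x)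

    pairLayer : Ground → Ground → List V → List V
    pairLayer a b (y ∷ z ∷ []) = layer a y ++ layer b z
    pairLayer a b _            = []

    sumLayer : Ground → Ground → Label → List V → List V
    sumLayer a b linl (y ∷ []) = layer a y
    sumLayer a b linr (y ∷ []) = layer b y
    sumLayer a b _    _        = []

  mutual
    length-layer≤width : ∀ τ x → length (layer τ x) ≤ width τ
    length-layer≤width unit    x = ≤-refl
    length-layer≤width (μ P)   x = ≤-refl
    length-layer≤width (a ⊗ b) x = s≤s (length-pairLayer≤ a b (succ G x))
    length-layer≤width (a ⊕ b) x = s≤s (length-sumLayer≤ a b (label G x) (succ G x))

    length-pairLayer≤ : ∀ a b ys → length (pairLayer a b ys) ≤ width a + width b
    length-pairLayer≤ a b []              = z≤n
    length-pairLayer≤ a b (_ ∷ [])        = z≤n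
    length-pairLayer≤ a b (y ∷ z ∷ [])    = begin
      length (layer a y ++ layer b z)          ≡⟨ length-++ (layer a y) ⟩
      length (layer a y) + length (layer b z)  ≤⟨ +-mono-≤ (length-layer≤width a y) (length-layer≤width b z) ⟩
      width a + width b                        ∎
      where open ≤-Reasoning
    length-pairLayer≤ a b (_ ∷ _ ∷ _ ∷ _) = z≤n

    length-sumLayer≤ : ∀ a b l ys → length (sumLayer a b l ys) ≤ width a + width b
    length-sumLayer≤ a b linl    (y ∷ [])    = ≤-trans (length-layer≤width a y) (m≤m+n _ _)
    length-sumLayer≤ a b linr    (y ∷ [])    = ≤-trans (length-layer≤width b y) (m≤n+m _ _)
    length-sumLayer≤ a b linl    []          = z≤n
    length-sumLayer≤ a b linl    (_ ∷ _ ∷ _) = z≤n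
    length-sumLayer≤ a b linr    []          = z≤n
    length-sumLayer≤ a b linr    (_ ∷ _ ∷ _) = z≤n
    length-sumLayer≤ a b lunit   _           = z≤n
    length-sumLayer≤ a b lpair   _           = z≤n
    length-sumLayer≤ a b (lcon _) _          = z≤n

  x∈layer : ∀ τ x → x ∈ layer τ x
  x∈layer unit    x = here refl
  x∈layer (μ P)   x = here refl
  x∈layer (a ⊗ b) x = here refl
  x∈layer (a ⊕ b) x = here refl

  layer-⊗ˡ : ∀ a b {x y z} → succ G x ≡ y ∷ z ∷ [] → layer a y ⊆ layer (a ⊗ b) x
  layer-⊗ˡ a b eq p rewrite eq = there (∈-++⁺ˡ p)

  layer-⊗ʳ : ∀ a b {x y z} → succ G x ≡ y ∷ z ∷ [] → layer b z ⊆ layer (a ⊗ b) x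
  layer-⊗ʳ a b {y = y} eq p rewrite eq = there (∈-++⁺ʳ (layer a y) p)

  layer-⊕ˡ : ∀ a b {x y} → label G x ≡ linl → succ G x ≡ y ∷ [] → layer a y ⊆ layer (a ⊕ b) x
  layer-⊕ˡ a b l eq p rewrite l | eq = there p

  layer-⊕ʳ : ∀ a b {x y} → label G x ≡ linr → succ G x ≡ y ∷ [] → layer b y ⊆ layer (a ⊕ b) x
  layer-⊕ʳ a b l eq p rewrite l | eq = there p

  module Covering (K : ℕ) (γ : Ground) (r : V) where

    data Anchor (τ : Ground) (w : V) : Set where
      top   : layer τ w ⊆ layer γ r → Anchor τ w
      below : ∀ {u P a} → label G u ≡ lcon P → succ G u ≡ a ∷ [] → width (apply P (μ P)) ≤ K →
              layer τ w ⊆ layer (apply P (μ P)) a → Anchor τ w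

    anchor-⊆ : ∀ {τ τ′ w w′} → Anchor τ w → layer τ′ w′ ⊆ layer τ w → Anchor τ′ w′
    anchor-⊆ (top s)          t = top (λ p → s (t p))
    anchor-⊆ (below l e wK s) t = below l e wK (λ p → s (t p))

    data Placed (w : V) : Set where
      placed : ∀ {τ} → IsValue G τ w → WidthBounded K τ → Anchor τ w → Placed w

    placed-succ : ∀ {u w} → Placed u → w ∈ succ G u → Placed w
    placed-succ {w = w} (placed (v-unit _ e) _ _) m with subst (w ∈_) e m
    ... | ()
    placed-succ {w = w} (placed (v-pair {γ₁} {γ₂} _ e t₁ t₂) (b₁ , b₂) an) m with subst (w ∈_) e m
    ... | here refl         = placed t₁ b₁ (anchor-⊆ an (layer-⊗ˡ γ₁ γ₂ e))
    ... | there (here refl) = placed t₂ b₂ (anchor-⊆ an (layer-⊗ʳ γ₁ γ₂ e))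
    placed-succ {w = w} (placed (v-inl {γ₁} {γ₂} l e t) (b₁ , _) an) m with subst (w ∈_) e m
    ... | here refl = placed t b₁ (anchor-⊆ an (layer-⊕ˡ γ₁ γ₂ l e))
    placed-succ {w = w} (placed (v-inr {γ₁} {γ₂} l e t) (_ , b₂) an) m with subst (w ∈_) e m
    ... | here refl = placed t b₂ (anchor-⊆ an (layer-⊕ʳ γ₁ γ₂ l e))
    placed-succ {w = w} (placed (v-con {P} l e t) bμ@(wK , bP) _) m with subst (w ∈_) e m
    ... | here refl = placed t (widthBounded-apply P P bμ bP) (below l e wK (λ p → p))

    placed-reach : IsValue G γ r → WidthBounded K γ → ∀ {w} → Reach G r w → Placed w
    placed-reach t b here        = placed t b (top (λ p → p))
    placed-reach t b (step rw m) = placed-succ (placed-reach t b rw) m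

    layerBelow : Label → List V → List V
    layerBelow (lcon P) (a ∷ []) = layer (apply P (μ P)) a
    layerBelow _        _        = []

    -- Truncating to K changes nothing at well-typed constructor vertices, and makes the
    -- length bound hold without any typing information.
    childLayer : V → List V
    childLayer u = take (K * isCon (label G u)) (layerBelow (label G u) (succ G u))

    layers : List V
    layers = take K (layer γ r) ++ concatMap childLayer (allFin (n G))

    ∈-layers : width γ ≤ K → ∀ {w} → Placed w → w ∈ layers
    ∈-layers wγ {w} (placed {τ} _ _ (top s)) =
      ∈-++⁺ˡ (subst (w ∈_) (sym (take-all K (layer γ r) (≤-trans (length-layer≤width γ r) wγ)))
                           (s (x∈layer τ w)))
    ∈-layers wγ {w} (placed {τ} _ _ (below {u} {P} {a} l e wK s)) =
      ∈-++⁺ʳ (take K (layer γ r)) (∈-concatMap⁺ childLayer (lose (∈-allFin u) w∈childLayer))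
      where
        w∈childLayer : w ∈ childLayer u
        w∈childLayer rewrite l | e =
          subst (w ∈_) (sym (take-all (K * 1) _ (begin
            length (layer (apply P (μ P)) a) ≤⟨ length-layer≤width (apply P (μ P)) a ⟩
            width (apply P (μ P))            ≤⟨ wK ⟩
            K                                ≡⟨ *-identityʳ K ⟨
            K * 1                            ∎)))
            (s (x∈layer τ w))
          where open ≤-Reasoning

    length-layers≤ : length layers ≤ K * (1 + sum (map (λ u → isCon (label G u)) (allFin (n G))))
    length-layers≤ = begin
      length layers
        ≡⟨ length-++ (take K (layer γ r)) ⟩
      length (take K (layer γ r)) + length (concatMap childLayer (allFin (n G)))
        ≤⟨ +-mono-≤ (length-take≤ K (layer γ r))
                    (length-concatMap≤ K childLayer (λ u → isCon (label G u))
                                        (λ u → length-take≤ _ _) (allFin (n G))) ⟩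
      K + K * sum (map (λ u → isCon (label G u)) (allFin (n G)))
        ≡⟨ *-suc K _ ⟨
      K * (1 + sum (map (λ u → isCon (label G u)) (allFin (n G)))) ∎
      where open ≤-Reasoning

lemma5 : (γ : Ground) → Σ ℕ (λ k → (v : ValueGraph γ) → vertices v ≤ k * (1 + size v))
lemma5 γ = widthBound γ , vertices≤
  where
    vertices≤ : (v : ValueGraph γ) → vertices v ≤ widthBound γ * (1 + size v)
    vertices≤ v = ≤-trans (complete⇒≤length layers ∈layers) length-layers≤
      where
        open Layers.Covering (graph v) (widthBound γ) γ (root v)
        ∈layers : ∀ w → w ∈ layers
        ∈layers w = ∈-layers (width≤widthBound γ)
          (placed-reach (typed v) (widthBounded γ ≤-refl) (rooted v w))
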